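{- Let $P$ be a multigraph pattern and $n$ a positive integer. Then: (i) if $G$ is a blow-up of $P$ on $[n]$ with $e(G)=\Sigma_P(n)$, then for every pair of distinct vertices $v,v'$ of $G$ we have $|d(v)-d(v')|\le w(vv')$; (ii) if $G$ is a blow-up of $P$ on $[n]$ with $P(G)=\Pi_P(n)$ and all pair and loop multiplicities of $P$ are strictly positive, then for every pair of distinct vertices $v,v'$ of $G$ we have $w(vv')^{ -1}p(v')\le p(v)\le w(vv')p(v')$.
   Context: A multigraph $G=(V,w)$ is a finite vertex set with $w\colon\binom V2\to\mathbb{Z}_{\ge0}$; $e(G)=\sum_{uv}w(uv)$, $P(G)=\prod_{uv}w(uv)$; the degree of $v$ is $d(v)=\sum_{u\in V\setminus\{v\}}w(uv)$ and its product degree is $p(v)=\prod_{u\in V\setminus\{v\}}w(uv)$. A pattern $P$ on a finite set $V(P)$ assigns non-negative integer multiplicities $P(\{v\})$ to vertices (loops) and $P(\{u,v\})$ to pairs. A blow-up of $P$ on $[n]$ is a multigraph on $[n]$ with a map $f\colon[n]\to V(P)$ (not necessarily surjective) such that $w(vv')=P(\{f(v),f(v')\})$ for distinct $v,v'$ (a loop multiplicity if $f(v)=f(v')$). $\Sigma_P(n)$ and $\Pi_P(n)$ are the maxima of $e(G)$ and $P(G)$ over blow-ups $G$ of $P$ on $[n]$. -}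

module Defs where

open import Data.Nat using (ℕ; _+_; _*_; _≤_; _<_; _<?_)
open import Data.Fin using (Fin; toℕ; _≟_)
open import Data.List using (map; allFin)
open import Data.Nat.ListAction using (sum; product)
open import Relation.Nullary using (does)
open import Relation.Binary.PropositionalEquality using (_≡_)
open import Data.Bool using (if_then_else_)

-- A multigraph on [n] = Fin n, given by its weight function on pairs.
-- Only the values w u v with u ≢ v are meaningful (diagonal ignored);
-- blow-ups below are always symmetric.
Multigraph : ℕ → Set
Multigraph n = Fin n → Fin n → ℕ

-- A pattern: vertex set V(P) = Fin k, multiplicity mult i j of the pair {i,j}
-- (for i ≡ j this is the loop multiplicity P({i})), symmetric.
record Pattern : Set where
  field
    k     : ℕ
    mult  : Fin k → Fin k → ℕ
    msym  : ∀ i j → mult i j ≡ mult j i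
open Pattern public

-- The blow-up of P on [n] along a map f : [n] → V(P) (not necessarily surjective).
blowUp : (P : Pattern) {n : ℕ} → (Fin n → Fin (k P)) → Multigraph n
blowUp P f v v' = mult P (f v) (f v')

e : {n : ℕ} → Multigraph n → ℕ
e {n} w = sum (map (λ u → sum (map (λ v → if does (toℕ u <? toℕ v) then w u v else 0) (allFin n))) (allFin n))

prodG : {n : ℕ} → Multigraph n → ℕ
prodG {n} w = product (map (λ u → product (map (λ v → if does (toℕ u <? toℕ v) then w u v else 1) (allFin n))) (allFin n))

deg : {n : ℕ} → Multigraph n → Fin n → ℕ
deg {n} w v = sum (map (λ u → if does (u ≟ v) then 0 else w u v) (allFin n))

pdeg : {n : ℕ} → Multigraph n → Fin n → ℕ
pdeg {n} w v = product (map (λ u → if does (u ≟ v) then 1 else w u v) (allFin n))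

-- blowUp P f attains Σ_P(n) = max of e over all blow-ups of P on [n]
AttainsΣ : (P : Pattern) (n : ℕ) → (Fin n → Fin (k P)) → Set
AttainsΣ P n f = ∀ (g : Fin n → Fin (k P)) → e (blowUp P g) ≤ e (blowUp P f)

-- blowUp P f attains Π_P(n) = max of P(G) over all blow-ups of P on [n]
AttainsΠ : (P : Pattern) (n : ℕ) → (Fin n → Fin (k P)) → Set
AttainsΠ P n f = ∀ (g : Fin n → Fin (k P)) → prodG (blowUp P g) ≤ prodG (blowUp P f)

AllPositive : Pattern → Set
AllPositive P = ∀ i j → 0 < mult P i j

module Submission where

-- Zykov symmetrisation. Moving a vertex v into the class of v′ (reassigning f v := f v′)
-- leaves G - v unchanged, so e changes by d_new(v) - d(v), and maximality of G forces
-- d_new(v) ≤ d(v). On the other hand d_new(v) + w(vv′) = d(v′) + P({f v′}), since both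
-- sum P(f u, f v′) over all u. Hence d(v′) ≤ d(v) + w(vv′); the product version is the
-- same computation in (ℕ, *, 1), where positivity makes the cancellation legitimate.

open import Defs
open import Algebra.Bundles using (CommutativeMonoid)
open import Data.Bool using (true; false; if_then_else_)
open import Data.Fin using (Fin; toℕ; _≟_; _<_; punchIn)
open import Data.Fin.Properties
  using (punchInᵢ≢i; punchIn-injective; punchIn-mono-≤; punchIn-cancel-≤; <-cmp; <-irrefl; <⇒≢; ≤∧≢⇒<)
open import Data.List using (foldr; map; allFin; tabulate)
open import Data.List.Properties using (map-cong; map-tabulate)
open import Data.List.Relation.Unary.All.Properties using (map⁺; tabulate⁺)
open import Data.Nat using (ℕ; zero; suc; _+_; _*_; _≤_; ∣_-_∣; z≤n; s≤s; NonZero; >-nonZero)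
open import Data.Nat.ListAction.Properties using (product≢0)
import Data.Nat.Properties as ℕ
open import Data.Product using (_×_; _,_)
open import Data.Vec.Functional using (Vector; removeAt; head; tail)
open import Function using (_∘_; mk⇔)
open import Relation.Binary using (tri<; tri≈; tri>)
open import Relation.Binary.PropositionalEquality as ≡ using (_≡_; _≢_; cong; cong₂; subst)
open import Relation.Nullary using (does; ¬_; contradiction)
open import Relation.Nullary.Decidable using (dec-true; dec-false; does-⇔)

punchIn-mono-< : ∀ {n} (v : Fin (suc n)) {i j : Fin n} → i < j → punchIn v i < punchIn v j
punchIn-mono-< v {i} {j} i<j =
  ≤∧≢⇒< (punchIn-mono-≤ v i j (ℕ.<⇒≤ i<j)) (<⇒≢ i<j ∘ punchIn-injective v i j)

punchIn-cancel-< : ∀ {n} (v : Fin (suc n)) {i j : Fin n} → punchIn v i < punchIn v j → i < j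
punchIn-cancel-< v {i} {j} lt =
  ≤∧≢⇒< (punchIn-cancel-≤ v i j (ℕ.<⇒≤ lt)) λ { ≡.refl → <-irrefl ≡.refl lt }

moveVertex : ∀ {a} {X : Set a} {n} → (Fin n → X) → Fin n → Fin n → Fin n → X
moveVertex f v v′ u = if does (u ≟ v) then f v′ else f u

moveVertex-moved : ∀ {a} {X : Set a} {n} (f : Fin n → X) v v′ → moveVertex f v v′ v ≡ f v′
moveVertex-moved f v v′ = cong (if_then f v′ else f v) (dec-true (v ≟ v) ≡.refl)

moveVertex-punchIn : ∀ {a} {X : Set a} {n} (f : Fin (suc n) → X) v v′ i →
  moveVertex f v v′ (punchIn v i) ≡ f (punchIn v i)
moveVertex-punchIn f v v′ i =
  cong (if_then f v′ else f (punchIn v i)) (dec-false (punchIn v i ≟ v) (punchInᵢ≢i v i))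

-- For (ℕ, +, 0) and (ℕ, *, 1), edgeTotal and degreeAt are definitionally e and deg,
-- resp. prodG and pdeg.
module EdgeTotals {c ℓ} (M : CommutativeMonoid c ℓ) where

  open CommutativeMonoid M
  open import Algebra.Properties.CommutativeMonoid.Sum M
  open import Algebra.Solver.CommutativeMonoid M using (solve; _⊕_; _⊜_)
  open import Relation.Binary.Reasoning.Setoid setoid

  upper : ∀ {n} → (Fin n → Fin n → Carrier) → Fin n → Fin n → Carrier
  upper w u x = if does (toℕ u ℕ.<? toℕ x) then w u x else ε

  edgeTotal : ∀ {n} → (Fin n → Fin n → Carrier) → Carrier
  edgeTotal {n} w = foldr _∙_ ε (map (λ u → foldr _∙_ ε (map (upper w u) (allFin n))) (allFin n))

  degreeAt : ∀ {n} → (Fin n → Fin n → Carrier) → Fin n → Carrier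
  degreeAt {n} w v = foldr _∙_ ε (map (λ u → if does (u ≟ v) then ε else w u v) (allFin n))

  deleteVertex : ∀ {n} → Fin (suc n) → (Fin (suc n) → Fin (suc n) → Carrier) → Fin n → Fin n → Carrier
  deleteVertex v w i j = w (punchIn v i) (punchIn v j)

  pullback : ∀ {a} {X : Set a} {n} → (X → X → Carrier) → (Fin n → X) → Fin n → Fin n → Carrier
  pullback m f u x = m (f u) (f x)

  foldr-tabulate : ∀ {n} (t : Vector Carrier n) → foldr _∙_ ε (tabulate t) ≡ sum t
  foldr-tabulate {zero}  t = ≡.refl
  foldr-tabulate {suc n} t = cong (head t ∙_) (foldr-tabulate (tail t))

  foldr-map-allFin : ∀ {n} (t : Vector Carrier n) → foldr _∙_ ε (map t (allFin n)) ≡ sum t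
  foldr-map-allFin t = ≡.trans (cong (foldr _∙_ ε) (map-tabulate (λ i → i) t)) (foldr-tabulate t)

  edgeTotal≡∑ : ∀ {n} (w : Fin n → Fin n → Carrier) → edgeTotal w ≡ ∑[ u < n ] ∑[ x < n ] upper w u x
  edgeTotal≡∑ {n} w =
    ≡.trans (foldr-map-allFin (λ u → foldr _∙_ ε (map (upper w u) (allFin n))))
            (sum-cong-≗ (foldr-map-allFin ∘ upper w))

  degreeAt≡∑ : ∀ {n} (w : Fin n → Fin n → Carrier) v →
    degreeAt w v ≡ ∑[ u < n ] (if does (u ≟ v) then ε else w u v)
  degreeAt≡∑ w v = foldr-map-allFin (λ u → if does (u ≟ v) then ε else w u v)

  sum-override : ∀ {n} (t : Vector Carrier (suc n)) v a →
    sum (λ u → if does (u ≟ v) then a else t u) ≈ a ∙ sum (removeAt t v)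
  sum-override t v a = begin
    sum t′                      ≈⟨ sum-remove {i = v} t′ ⟩
    t′ v ∙ sum (removeAt t′ v)  ≡⟨ cong₂ _∙_ at-v (sum-cong-≗ off-v) ⟩
    a ∙ sum (removeAt t v)      ∎
    where
    t′ = λ u → if does (u ≟ v) then a else t u
    at-v : t′ v ≡ a
    at-v = cong (if_then a else t v) (dec-true (v ≟ v) ≡.refl)
    off-v : ∀ i → t′ (punchIn v i) ≡ t (punchIn v i)
    off-v i = cong (if_then a else t (punchIn v i)) (dec-false (punchIn v i ≟ v) (punchInᵢ≢i v i))

  degreeAt-punchIn : ∀ {n} (w : Fin (suc n) → Fin (suc n) → Carrier) v →
    degreeAt w v ≈ ∑[ i < n ] w (punchIn v i) v
  degreeAt-punchIn w v =
    trans (reflexive (degreeAt≡∑ w v)) (trans (sum-override (λ u → w u v) v ε) (identityˡ _))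

  upper-< : ∀ {n} (w : Fin n → Fin n → Carrier) {u x} → u < x → upper w u x ≡ w u x
  upper-< w {u} {x} u<x = cong (if_then w u x else ε) (dec-true (toℕ u ℕ.<? toℕ x) u<x)

  upper-≮ : ∀ {n} (w : Fin n → Fin n → Carrier) {u x} → ¬ u < x → upper w u x ≡ ε
  upper-≮ w {u} {x} u≮x = cong (if_then w u x else ε) (dec-false (toℕ u ℕ.<? toℕ x) u≮x)

  upper-pair : ∀ {n} (w : Fin n → Fin n → Carrier) → (∀ u x → w u x ≈ w x u) →
    ∀ {u v} → u ≢ v → upper w v u ∙ upper w u v ≈ w u v
  upper-pair w w-sym {u} {v} u≢v with <-cmp u v
  ... | tri< u<v _ v≮u = begin
    upper w v u ∙ upper w u v  ≡⟨ cong₂ _∙_ (upper-≮ w v≮u) (upper-< w u<v) ⟩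
    ε ∙ w u v                  ≈⟨ identityˡ _ ⟩
    w u v                      ∎
  ... | tri≈ _ u≡v _ = contradiction u≡v u≢v
  ... | tri> u≮v _ v<u = begin
    upper w v u ∙ upper w u v  ≡⟨ cong₂ _∙_ (upper-< w v<u) (upper-≮ w u≮v) ⟩
    w v u ∙ ε                  ≈⟨ identityʳ _ ⟩
    w v u                      ≈⟨ w-sym v u ⟩
    w u v                      ∎

  upper-punchIn : ∀ {n} (w : Fin (suc n) → Fin (suc n) → Carrier) v i j →
    upper w (punchIn v i) (punchIn v j) ≡ upper (deleteVertex v w) i j
  upper-punchIn w v i j =
    cong (if_then deleteVertex v w i j else ε)
      (does-⇔ (mk⇔ (punchIn-cancel-< v) (punchIn-mono-< v))
        (toℕ (punchIn v i) ℕ.<? toℕ (punchIn v j)) (toℕ i ℕ.<? toℕ j))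

  -- Both sums over the pairs through v collapse to the degree because
  -- exactly one of upper w v u and upper w u v survives for u ≢ v.
  edgeTotal-deleteVertex : ∀ {n} (w : Fin (suc n) → Fin (suc n) → Carrier) →
    (∀ u x → w u x ≈ w x u) → ∀ v → edgeTotal w ≈ degreeAt w v ∙ edgeTotal (deleteVertex v w)
  edgeTotal-deleteVertex {n} w w-sym v = begin
    edgeTotal w
      ≡⟨ edgeTotal≡∑ w ⟩
    ∑[ u < suc n ] sum (U u)
      ≈⟨ sum-remove {i = v} (λ u → sum (U u)) ⟩
    sum (U v) ∙ ∑[ i < n ] sum (U (π i))
      ≈⟨ ∙-congˡ (sum-cong-≋ λ i → sum-remove {i = v} (U (π i))) ⟩
    sum (U v) ∙ ∑[ i < n ] (U (π i) v ∙ ∑[ j < n ] U (π i) (π j))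
      ≈⟨ ∙-cong (sum-remove {i = v} (U v))
                (∑-distrib-+ (λ i → U (π i) v) (λ i → ∑[ j < n ] U (π i) (π j))) ⟩
    (U v v ∙ A) ∙ (B ∙ ∑[ i < n ] ∑[ j < n ] U (π i) (π j))
      ≡⟨ cong₂ (λ d r → (d ∙ A) ∙ (B ∙ r)) (upper-≮ w (<-irrefl ≡.refl)) restricted ⟩
    (ε ∙ A) ∙ (B ∙ R)
      ≈⟨ ∙-congʳ (identityˡ A) ⟩
    A ∙ (B ∙ R)
      ≈⟨ sym (assoc A B R) ⟩
    (A ∙ B) ∙ R
      ≈⟨ ∙-congʳ (sym (∑-distrib-+ (λ i → U v (π i)) (λ i → U (π i) v))) ⟩
    ∑[ i < n ] (U v (π i) ∙ U (π i) v) ∙ R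
      ≈⟨ ∙-congʳ (sum-cong-≋ λ i → upper-pair w w-sym (punchInᵢ≢i v i)) ⟩
    ∑[ i < n ] w (π i) v ∙ R
      ≈⟨ ∙-congʳ (sym (degreeAt-punchIn w v)) ⟩
    degreeAt w v ∙ R
      ∎
    where
    U = upper w
    π = punchIn v
    A = ∑[ i < n ] U v (π i)
    B = ∑[ i < n ] U (π i) v
    R = edgeTotal (deleteVertex v w)
    restricted : ∑[ i < n ] ∑[ j < n ] U (π i) (π j) ≡ R
    restricted = ≡.trans (sum-cong-≗ λ i → sum-cong-≗ (upper-punchIn w v i))
                         (≡.sym (edgeTotal≡∑ (deleteVertex v w)))

  edgeTotal-cong : ∀ {n} {w w′ : Fin n → Fin n → Carrier} → (∀ u x → w u x ≡ w′ u x) →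
    edgeTotal w ≡ edgeTotal w′
  edgeTotal-cong {n} w≗w′ =
    cong (foldr _∙_ ε) (map-cong (λ u →
      cong (foldr _∙_ ε) (map-cong (λ x → cong (if does (toℕ u ℕ.<? toℕ x) then_else ε) (w≗w′ u x))
        (allFin n))) (allFin n))

  module _ {a} {X : Set a} (m : X → X → Carrier) {n} (f : Fin (suc n) → X) (v v′ : Fin (suc n)) where

    private
      g = moveVertex f v v′

    -- G and its symmetrisation differ only at v, so they share G - v.
    edgeTotal-moveVertex : (∀ x y → m x y ≈ m y x) →
      edgeTotal (pullback m g) ∙ degreeAt (pullback m f) v
        ≈ edgeTotal (pullback m f) ∙ degreeAt (pullback m g) v
    edgeTotal-moveVertex m-sym = begin
      edgeTotal wg ∙ Df        ≈⟨ ∙-congʳ (edgeTotal-deleteVertex wg (λ u x → m-sym (g u) (g x)) v) ⟩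
      (Dg ∙ Rg) ∙ Df           ≡⟨ cong (λ r → (Dg ∙ r) ∙ Df) same-deletion ⟩
      (Dg ∙ Rf) ∙ Df           ≈⟨ solve 3 (λ x y z → (x ⊕ y) ⊕ z ⊜ (z ⊕ y) ⊕ x) refl Dg Rf Df ⟩
      (Df ∙ Rf) ∙ Dg           ≈⟨ ∙-congʳ (sym (edgeTotal-deleteVertex wf (λ u x → m-sym (f u) (f x)) v)) ⟩
      edgeTotal wf ∙ Dg        ∎
      where
      wf = pullback m f
      wg = pullback m g
      Df = degreeAt wf v
      Dg = degreeAt wg v
      Rf = edgeTotal (deleteVertex v wf)
      Rg = edgeTotal (deleteVertex v wg)
      same-deletion : Rg ≡ Rf
      same-deletion = edgeTotal-cong λ i j →
        cong₂ m (moveVertex-punchIn f v v′ i) (moveVertex-punchIn f v v′ j)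

    -- Both sides are the sum of m (f u) (f v′) over all vertices u.
    degreeAt-moveVertex :
      degreeAt (pullback m g) v ∙ m (f v) (f v′) ≈ degreeAt (pullback m f) v′ ∙ m (f v′) (f v′)
    degreeAt-moveVertex = begin
      degreeAt (pullback m g) v ∙ h v      ≈⟨ ∙-congʳ (degreeAt-punchIn (pullback m g) v) ⟩
      ∑[ i < n ] m (g (π i)) (g v) ∙ h v   ≡⟨ cong (_∙ h v) (sum-cong-≗ λ i →
                                                 cong₂ m (moveVertex-punchIn f v v′ i) (moveVertex-moved f v v′)) ⟩
      sum (removeAt h v) ∙ h v             ≈⟨ comm _ _ ⟩
      h v ∙ sum (removeAt h v)             ≈⟨ sum-remove {i = v} h ⟨
      sum h                                ≈⟨ sum-remove {i = v′} h ⟩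
      h v′ ∙ sum (removeAt h v′)           ≈⟨ comm _ _ ⟩
      sum (removeAt h v′) ∙ h v′           ≈⟨ ∙-congʳ (degreeAt-punchIn (pullback m f) v′) ⟨
      degreeAt (pullback m f) v′ ∙ h v′    ∎
      where
      π = punchIn v
      h = λ u → m (f u) (f v′)

module Σ = EdgeTotals ℕ.+-0-commutativeMonoid
module Π = EdgeTotals ℕ.*-1-commutativeMonoid

prodG-nonZero : ∀ {n} (w : Fin n → Fin n → ℕ) → (∀ u x → NonZero (w u x)) → NonZero (prodG w)
prodG-nonZero w w≢0 =
  product≢0 (map⁺ (tabulate⁺ λ u → product≢0 (map⁺ (tabulate⁺ (entry≢0 u)))))
  where
  entry≢0 : ∀ u x → NonZero (if does (toℕ u ℕ.<? toℕ x) then w u x else 1)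
  entry≢0 u x with does (toℕ u ℕ.<? toℕ x)
  ... | true  = w≢0 u x
  ... | false = _

m≤n+o∧n≤m+o⇒∣m-n∣≤o : ∀ {m n o} → m ≤ n + o → n ≤ m + o → ∣ m - n ∣ ≤ o
m≤n+o∧n≤m+o⇒∣m-n∣≤o {zero}  {n}     _         n≤o       = n≤o
m≤n+o∧n≤m+o⇒∣m-n∣≤o {suc m} {zero}  m≤o       _         = m≤o
m≤n+o∧n≤m+o⇒∣m-n∣≤o {suc m} {suc n} (s≤s m≤n+o) (s≤s n≤m+o) = m≤n+o∧n≤m+o⇒∣m-n∣≤o m≤n+o n≤m+o

module _ (P : Pattern) {n : ℕ} (f : Fin (suc n) → Fin (k P)) (v v′ : Fin (suc n)) where

  open ℕ.≤-Reasoning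

  private
    g = moveVertex f v v′
    wf = blowUp P f
    wg = blowUp P g
    loop = mult P (f v′) (f v′)

  AttainsΣ⇒deg≤deg+w : AttainsΣ P (suc n) f → deg wf v′ ≤ deg wf v + wf v v′
  AttainsΣ⇒deg≤deg+w maximal = begin
    deg wf v′           ≤⟨ ℕ.m≤m+n _ loop ⟩
    deg wf v′ + loop    ≡⟨ Σ.degreeAt-moveVertex (mult P) f v v′ ⟨
    deg wg v + wf v v′  ≤⟨ ℕ.+-monoˡ-≤ (wf v v′) moving-v-loses ⟩
    deg wf v + wf v v′  ∎
    where
    moving-v-loses : deg wg v ≤ deg wf v
    moving-v-loses = ℕ.+-cancelˡ-≤ (e wf) _ _ (begin
      e wf + deg wg v  ≡⟨ Σ.edgeTotal-moveVertex (mult P) f v v′ (msym P) ⟨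
      e wg + deg wf v  ≤⟨ ℕ.+-monoˡ-≤ (deg wf v) (maximal g) ⟩
      e wf + deg wf v  ∎)

  AttainsΠ⇒pdeg≤w*pdeg : AttainsΠ P (suc n) f → AllPositive P → pdeg wf v′ ≤ wf v v′ * pdeg wf v
  AttainsΠ⇒pdeg≤w*pdeg maximal positive = begin
    pdeg wf v′           ≤⟨ ℕ.m≤m*n _ loop ⟩
    pdeg wf v′ * loop    ≡⟨ Π.degreeAt-moveVertex (mult P) f v v′ ⟨
    pdeg wg v * wf v v′  ≤⟨ ℕ.*-monoˡ-≤ (wf v v′) moving-v-loses ⟩
    pdeg wf v * wf v v′  ≡⟨ ℕ.*-comm (pdeg wf v) (wf v v′) ⟩
    wf v v′ * pdeg wf v  ∎
    where
    instance
      mult≢0 : ∀ {i j} → NonZero (mult P i j)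
      mult≢0 = >-nonZero (positive _ _)
      prodG≢0 : NonZero (prodG wf)
      prodG≢0 = prodG-nonZero wf λ _ _ → mult≢0
    moving-v-loses : pdeg wg v ≤ pdeg wf v
    moving-v-loses = ℕ.*-cancelˡ-≤ (prodG wf) (begin
      prodG wf * pdeg wg v  ≡⟨ Π.edgeTotal-moveVertex (mult P) f v v′ (msym P) ⟨
      prodG wg * pdeg wf v  ≤⟨ ℕ.*-monoˡ-≤ (pdeg wf v) (maximal g) ⟩
      prodG wf * pdeg wf v  ∎)

lemma2p4 : (P : Pattern) (n : ℕ) → 1 ≤ n →
  (∀ (f : Fin n → Fin (k P)) → AttainsΣ P n f →
    ∀ (v v' : Fin n) → v ≢ v' →
      ∣ deg (blowUp P f) v - deg (blowUp P f) v' ∣ ≤ blowUp P f v v')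
  ×
  (∀ (f : Fin n → Fin (k P)) → AttainsΠ P n f → AllPositive P →
    ∀ (v v' : Fin n) → v ≢ v' →
      (pdeg (blowUp P f) v' ≤ blowUp P f v v' * pdeg (blowUp P f) v)
      × (pdeg (blowUp P f) v ≤ blowUp P f v v' * pdeg (blowUp P f) v'))
lemma2p4 P (suc n) (s≤s z≤n) = degree-gap , product-degree-ratio
  where
  degree-gap : ∀ f → AttainsΣ P (suc n) f → ∀ v v′ → v ≢ v′ →
    ∣ deg (blowUp P f) v - deg (blowUp P f) v′ ∣ ≤ blowUp P f v v′
  degree-gap f maximal v v′ _ = m≤n+o∧n≤m+o⇒∣m-n∣≤o
    (subst (λ w → deg (blowUp P f) v ≤ deg (blowUp P f) v′ + w) (msym P (f v′) (f v))
      (AttainsΣ⇒deg≤deg+w P f v′ v maximal))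
    (AttainsΣ⇒deg≤deg+w P f v v′ maximal)

  product-degree-ratio : ∀ f → AttainsΠ P (suc n) f → AllPositive P → ∀ v v′ → v ≢ v′ →
    (pdeg (blowUp P f) v′ ≤ blowUp P f v v′ * pdeg (blowUp P f) v)
    × (pdeg (blowUp P f) v ≤ blowUp P f v v′ * pdeg (blowUp P f) v′)
  product-degree-ratio f maximal positive v v′ _ =
    AttainsΠ⇒pdeg≤w*pdeg P f v v′ maximal positive ,
    subst (λ w → pdeg (blowUp P f) v ≤ w * pdeg (blowUp P f) v′) (msym P (f v′) (f v))
      (AttainsΠ⇒pdeg≤w*pdeg P f v′ v maximal positive)
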